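{- Let $\mathrm{avg\,val}(G)=\frac{\sum_{v\in V(G)}\mathrm{degree}(v)}{|V(G)|}$ be the average degree of a finite graph $G$ with at least one vertex. Then the connection matrix $M(\sqcup,\mathrm{avg\,val})$ has infinite rank.
   Context: $M(\sqcup,\mathrm{avg\,val})$ is the infinite matrix with rows and columns indexed by finite (nonempty) graphs, whose entry at $(G,H)$ is $\mathrm{avg\,val}(G\sqcup H)$, where $G\sqcup H$ is the disjoint union; rank is over $\mathbb{Q}$. -}

module Defs where

open import Data.Nat using (ℕ; zero; suc)
import Data.Nat as ℕ
open import Data.Bool using (Bool; true; false; if_then_else_)
open import Data.Fin using (Fin; splitAt)
open import Data.Sum using (_⊎_; inj₁; inj₂)
open import Data.List using (List; map; allFin; foldr)
open import Data.Nat.ListAction using (sum)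
open import Data.Product using (Σ)
open import Data.Integer using (+_)
open import Data.Rational using (ℚ; _/_; _+_; _*_; 0ℚ)
open import Relation.Binary.PropositionalEquality using (_≡_; refl; sym)

record Graph : Set where
  field
    pred-order : ℕ
    adj   : Fin (suc pred-order) → Fin (suc pred-order) → Bool
    adj-sym   : ∀ i j → adj i j ≡ adj j i
    adj-irrefl : ∀ i → adj i i ≡ false
open Graph public

order : Graph → ℕ
order G = suc (pred-order G)

sumFin : (n : ℕ) → (Fin n → ℕ) → ℕ
sumFin n f = sum (map f (allFin n))

boolToℕ : Bool → ℕ
boolToℕ true = 1
boolToℕ false = 0

degree : (G : Graph) → Fin (order G) → ℕ
degree G v = sumFin (order G) (λ w → boolToℕ (adj G v w))

avgVal : Graph → ℚ
avgVal G = (+ sumFin (order G) (degree G)) / order G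

-- Disjoint union: vertices of G come first, then those of H.
module _ (G H : Graph) where
  private
    a = order G
    b = order H
    uadjS : Fin a ⊎ Fin b → Fin a ⊎ Fin b → Bool
    uadjS (inj₁ i) (inj₁ j) = adj G i j
    uadjS (inj₂ i) (inj₂ j) = adj H i j
    uadjS (inj₁ _) (inj₂ _) = false
    uadjS (inj₂ _) (inj₁ _) = false

    uadjS-sym : ∀ x y → uadjS x y ≡ uadjS y x
    uadjS-sym (inj₁ i) (inj₁ j) = adj-sym G i j
    uadjS-sym (inj₂ i) (inj₂ j) = adj-sym H i j
    uadjS-sym (inj₁ _) (inj₂ _) = refl
    uadjS-sym (inj₂ _) (inj₁ _) = refl

    uadjS-irr : ∀ x → uadjS x x ≡ false
    uadjS-irr (inj₁ i) = adj-irrefl G i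
    uadjS-irr (inj₂ i) = adj-irrefl H i

  _⊔_ : Graph
  _⊔_ = record
    { pred-order = pred-order G ℕ.+ order H
    ; adj = λ i j → uadjS (splitAt a i) (splitAt a j)
    ; adj-sym = λ i j → uadjS-sym (splitAt a i) (splitAt a j)
    ; adj-irrefl = λ i → uadjS-irr (splitAt a i)
    }

M : Graph → Graph → ℚ
M G H = avgVal (G ⊔ H)

sumℚ : (n : ℕ) → (Fin n → ℚ) → ℚ
sumℚ n f = foldr _+_ 0ℚ (map f (allFin n))

RowsIndependent : (n : ℕ) → (Fin n → Graph) → Set
RowsIndependent n Gs =
  (c : Fin n → ℚ) →
  ((H : Graph) → sumℚ n (λ i → c i * M (Gs i) H) ≡ 0ℚ) →
  (i : Fin n) → c i ≡ 0ℚ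

InfiniteRank : Set
InfiniteRank = (n : ℕ) → Σ (Fin n → Graph) (RowsIndependent n)

-- Let Eₘ be the edgeless graph on m + 1 vertices and K₂ a single edge.  Degree sums
-- and orders add under ⊔, so the entry of M at (Eₘ, K₂ ⊔ Eₖ) is 2 / (m + k + 4):
-- these rows and columns form a Cauchy matrix.  If Σᵢ cᵢ / (aᵢ + k) vanishes for all
-- k ∈ ℕ, clearing denominators gives a polynomial of degree < n with infinitely many
-- zeros; extrapolating it by finite differences to the points -aⱼ, where all terms
-- but the j-th vanish, forces every cⱼ = 0.

module Submission where

open import Defs
open import Data.Bool using (Bool; true; false)
open import Data.Fin using (Fin; zero; suc; toℕ; _↑ˡ_; _↑ʳ_)
open import Data.Fin.Properties using (splitAt-↑ˡ; splitAt-↑ʳ; suc-injective; toℕ-injective)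
import Data.Integer as ℤ
import Data.Integer.Properties as ℤ
open import Data.Integer.Tactic.RingSolver using (solve-∀)
open import Data.List using (_∷_; map; foldr; allFin)
open import Data.List.Properties using (map-tabulate; map-cong)
open import Data.Nat using (ℕ; zero; suc; _≤_; z≤n; s≤s)
import Data.Nat as ℕ
open import Data.Nat.ListAction using (sum)
import Data.Nat.Properties as ℕ
open import Data.Product using (_,_)
open import Data.Rational hiding (_≤_; _⊔_)
open import Data.Rational.Properties
open import Data.Rational.Solver using (module +-*-Solver)
import Data.Rational.Unnormalised as ℚᵘ
import Data.Rational.Unnormalised.Properties as ℚᵘ
open import Function using (_∘_; id)
open import Function.Definitions using (Injective)
open import Relation.Binary.PropositionalEquality
open import Relation.Nullary using (yes; no; contradiction)
open import Algebra.Definitions.RawMonoid +-0-rawMonoid using (_×_)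
open import Algebra.Properties.Group +-0-group using (x∙y⁻¹≈ε⇒x≈y)
open import Algebra.Properties.Monoid.Mult +-0-monoid using (×-homo-+)
open import Algebra.Apartness.Properties.HeytingCommutativeRing heytingCommutativeRing
  using (x#0y#0→xy#0)
open +-*-Solver

map-allFin-suc : ∀ {A : Set} n (f : Fin (suc n) → A) →
                 map f (allFin (suc n)) ≡ f zero ∷ map (f ∘ suc) (allFin n)
map-allFin-suc n f =
  cong (f zero ∷_) (trans (map-tabulate suc f) (sym (map-tabulate id (f ∘ suc))))

sumFin-suc : ∀ n (f : Fin (suc n) → ℕ) → sumFin (suc n) f ≡ f zero ℕ.+ sumFin n (f ∘ suc)
sumFin-suc n f = cong sum (map-allFin-suc n f)

sumFin-cong : ∀ n {f g : Fin n → ℕ} → f ≗ g → sumFin n f ≡ sumFin n g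
sumFin-cong n f≗g = cong sum (map-cong f≗g (allFin n))

sumFin-zero : ∀ n → sumFin n (λ _ → 0) ≡ 0
sumFin-zero zero    = refl
sumFin-zero (suc n) = trans (sumFin-suc n (λ _ → 0)) (sumFin-zero n)

sumFin-+ : ∀ m n (f : Fin (m ℕ.+ n) → ℕ) →
           sumFin (m ℕ.+ n) f ≡ sumFin m (f ∘ (_↑ˡ n)) ℕ.+ sumFin n (f ∘ (m ↑ʳ_))
sumFin-+ zero    n f = refl
sumFin-+ (suc m) n f = begin
  sumFin (suc m ℕ.+ n) f                  ≡⟨ sumFin-suc (m ℕ.+ n) f ⟩
  f zero ℕ.+ sumFin (m ℕ.+ n) (f ∘ suc)   ≡⟨ cong (f zero ℕ.+_) (sumFin-+ m n (f ∘ suc)) ⟩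
  f zero ℕ.+ (left ℕ.+ right)             ≡⟨ ℕ.+-assoc (f zero) left right ⟨
  (f zero ℕ.+ left) ℕ.+ right             ≡⟨ cong (ℕ._+ right) (sumFin-suc m (f ∘ (_↑ˡ n))) ⟨
  sumFin (suc m) (f ∘ (_↑ˡ n)) ℕ.+ right  ∎
  where
  open ≡-Reasoning
  left  = sumFin m (f ∘ suc ∘ (_↑ˡ n))
  right = sumFin n (f ∘ (suc m ↑ʳ_))

degreeSum : Graph → ℕ
degreeSum G = sumFin (order G) (degree G)

module _ (G H : Graph) where

  adj-⊔-↑ˡ-↑ˡ : ∀ i j → adj (G ⊔ H) (i ↑ˡ order H) (j ↑ˡ order H) ≡ adj G i j
  adj-⊔-↑ˡ-↑ˡ i j
    rewrite splitAt-↑ˡ (order G) i (order H) | splitAt-↑ˡ (order G) j (order H) = refl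

  adj-⊔-↑ˡ-↑ʳ : ∀ i j → adj (G ⊔ H) (i ↑ˡ order H) (order G ↑ʳ j) ≡ false
  adj-⊔-↑ˡ-↑ʳ i j
    rewrite splitAt-↑ˡ (order G) i (order H) | splitAt-↑ʳ (order G) (order H) j = refl

  adj-⊔-↑ʳ-↑ˡ : ∀ i j → adj (G ⊔ H) (order G ↑ʳ i) (j ↑ˡ order H) ≡ false
  adj-⊔-↑ʳ-↑ˡ i j
    rewrite splitAt-↑ʳ (order G) (order H) i | splitAt-↑ˡ (order G) j (order H) = refl

  adj-⊔-↑ʳ-↑ʳ : ∀ i j → adj (G ⊔ H) (order G ↑ʳ i) (order G ↑ʳ j) ≡ adj H i j
  adj-⊔-↑ʳ-↑ʳ i j
    rewrite splitAt-↑ʳ (order G) (order H) i | splitAt-↑ʳ (order G) (order H) j = refl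

  degree-⊔-↑ˡ : ∀ i → degree (G ⊔ H) (i ↑ˡ order H) ≡ degree G i
  degree-⊔-↑ˡ i = begin
    degree (G ⊔ H) (i ↑ˡ order H)
      ≡⟨ sumFin-+ (order G) (order H) _ ⟩
    sumFin (order G) (boolToℕ ∘ adj (G ⊔ H) (i ↑ˡ order H) ∘ (_↑ˡ order H))
      ℕ.+ sumFin (order H) (boolToℕ ∘ adj (G ⊔ H) (i ↑ˡ order H) ∘ (order G ↑ʳ_))
      ≡⟨ cong₂ ℕ._+_ (sumFin-cong (order G) (cong boolToℕ ∘ adj-⊔-↑ˡ-↑ˡ i))
                     (trans (sumFin-cong (order H) (cong boolToℕ ∘ adj-⊔-↑ˡ-↑ʳ i))
                            (sumFin-zero (order H))) ⟩
    degree G i ℕ.+ 0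
      ≡⟨ ℕ.+-identityʳ (degree G i) ⟩
    degree G i ∎
    where open ≡-Reasoning

  degree-⊔-↑ʳ : ∀ i → degree (G ⊔ H) (order G ↑ʳ i) ≡ degree H i
  degree-⊔-↑ʳ i = begin
    degree (G ⊔ H) (order G ↑ʳ i)
      ≡⟨ sumFin-+ (order G) (order H) _ ⟩
    sumFin (order G) (boolToℕ ∘ adj (G ⊔ H) (order G ↑ʳ i) ∘ (_↑ˡ order H))
      ℕ.+ sumFin (order H) (boolToℕ ∘ adj (G ⊔ H) (order G ↑ʳ i) ∘ (order G ↑ʳ_))
      ≡⟨ cong₂ ℕ._+_ (trans (sumFin-cong (order G) (cong boolToℕ ∘ adj-⊔-↑ʳ-↑ˡ i))
                            (sumFin-zero (order G)))
                     (sumFin-cong (order H) (cong boolToℕ ∘ adj-⊔-↑ʳ-↑ʳ i)) ⟩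
    degree H i ∎
    where open ≡-Reasoning

  degreeSum-⊔ : degreeSum (G ⊔ H) ≡ degreeSum G ℕ.+ degreeSum H
  degreeSum-⊔ = trans (sumFin-+ (order G) (order H) (degree (G ⊔ H)))
    (cong₂ ℕ._+_ (sumFin-cong (order G) degree-⊔-↑ˡ) (sumFin-cong (order H) degree-⊔-↑ʳ))

edgeless : ℕ → Graph
edgeless m = record
  { pred-order = m ; adj = λ _ _ → false ; adj-sym = λ _ _ → refl ; adj-irrefl = λ _ → refl }

degreeSum-edgeless : ∀ m → degreeSum (edgeless m) ≡ 0
degreeSum-edgeless m =
  trans (sumFin-cong (suc m) (λ _ → sumFin-zero (suc m))) (sumFin-zero (suc m))

K₂ : Graph
K₂ = record { pred-order = 1 ; adj = edge ; adj-sym = edge-sym ; adj-irrefl = edge-irrefl }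
  where
  edge : Fin 2 → Fin 2 → Bool
  edge zero    zero    = false
  edge zero    (suc _) = true
  edge (suc _) zero    = true
  edge (suc _) (suc _) = false

  edge-sym : ∀ i j → edge i j ≡ edge j i
  edge-sym zero    zero    = refl
  edge-sym zero    (suc _) = refl
  edge-sym (suc _) zero    = refl
  edge-sym (suc _) (suc _) = refl

  edge-irrefl : ∀ i → edge i i ≡ false
  edge-irrefl zero    = refl
  edge-irrefl (suc _) = refl

M-edgeless-K₂⊔edgeless : ∀ m k →
  M (edgeless m) (K₂ ⊔ edgeless k) ≡ ℤ.+ 2 / (suc m ℕ.+ (3 ℕ.+ k))
M-edgeless-K₂⊔edgeless m k = cong (λ s → ℤ.+ s / (suc m ℕ.+ (3 ℕ.+ k))) (begin
  degreeSum (edgeless m ⊔ (K₂ ⊔ edgeless k))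
    ≡⟨ degreeSum-⊔ (edgeless m) (K₂ ⊔ edgeless k) ⟩
  degreeSum (edgeless m) ℕ.+ degreeSum (K₂ ⊔ edgeless k)
    ≡⟨ cong₂ ℕ._+_ (degreeSum-edgeless m) (degreeSum-⊔ K₂ (edgeless k)) ⟩
  degreeSum K₂ ℕ.+ degreeSum (edgeless k)
    ≡⟨ cong (2 ℕ.+_) (degreeSum-edgeless k) ⟩
  2 ∎)
  where open ≡-Reasoning

fromℕ : ℕ → ℚ
fromℕ n = n × 1ℚ

fromℕ-+ : ∀ m n → fromℕ (m ℕ.+ n) ≡ fromℕ m + fromℕ n
fromℕ-+ = ×-homo-+ 1ℚ

toℚᵘ-fromℕ : ∀ n → toℚᵘ (fromℕ n) ℚᵘ.≃ ℚᵘ.mkℚᵘ (ℤ.+ n) 0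
toℚᵘ-fromℕ zero    = ℚᵘ.*≡* refl
toℚᵘ-fromℕ (suc n) = begin
  toℚᵘ (1ℚ + fromℕ n)            ≈⟨ toℚᵘ-homo-+ 1ℚ (fromℕ n) ⟩
  toℚᵘ 1ℚ ℚᵘ.+ toℚᵘ (fromℕ n)    ≈⟨ ℚᵘ.+-congʳ (toℚᵘ 1ℚ) (toℚᵘ-fromℕ n) ⟩
  ℚᵘ.1ℚᵘ ℚᵘ.+ ℚᵘ.mkℚᵘ (ℤ.+ n) 0  ≈⟨ ℚᵘ.*≡* (cross-multiplied (ℤ.+ n)) ⟩
  ℚᵘ.mkℚᵘ (ℤ.+ suc n) 0          ∎
  where
  open ℚᵘ.≃-Reasoning
  cross-multiplied : ∀ x → (ℤ.1ℤ ℤ.* ℤ.1ℤ ℤ.+ x ℤ.* ℤ.1ℤ) ℤ.* ℤ.1ℤ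
                         ≡ (ℤ.1ℤ ℤ.+ x) ℤ.* (ℤ.1ℤ ℤ.* ℤ.1ℤ)
  cross-multiplied = solve-∀

fromℕ-injective : ∀ {m n} → fromℕ m ≡ fromℕ n → m ≡ n
fromℕ-injective {m} {n} eq
  with ℚᵘ.*≡* m*1≡n*1 ← ℚᵘ.≃-trans (ℚᵘ.≃-sym (toℚᵘ-fromℕ m))
                          (ℚᵘ.≃-trans (toℚᵘ-cong eq) (toℚᵘ-fromℕ n))
  = ℤ.+-injective (begin
    ℤ.+ m            ≡⟨ ℤ.*-identityʳ (ℤ.+ m) ⟨
    ℤ.+ m ℤ.* ℤ.1ℤ   ≡⟨ m*1≡n*1 ⟩
    ℤ.+ n ℤ.* ℤ.1ℤ   ≡⟨ ℤ.*-identityʳ (ℤ.+ n) ⟩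
    ℤ.+ n            ∎)
  where open ≡-Reasoning

/-*-fromℕ : ∀ m n → (ℤ.+ m / suc n) * fromℕ (suc n) ≡ fromℕ m
/-*-fromℕ m n = toℚᵘ-injective (begin
  toℚᵘ ((ℤ.+ m / suc n) * fromℕ (suc n))
    ≈⟨ toℚᵘ-homo-* (ℤ.+ m / suc n) (fromℕ (suc n)) ⟩
  toℚᵘ (ℤ.+ m / suc n) ℚᵘ.* toℚᵘ (fromℕ (suc n))
    ≈⟨ ℚᵘ.*-cong (toℚᵘ-fromℚᵘ (ℚᵘ.mkℚᵘ (ℤ.+ m) n)) (toℚᵘ-fromℕ (suc n)) ⟩
  ℚᵘ.mkℚᵘ (ℤ.+ m) n ℚᵘ.* ℚᵘ.mkℚᵘ (ℤ.+ suc n) 0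
    ≈⟨ ℚᵘ.*≡* (cross-multiplied (ℤ.+ m) (ℤ.+ suc n)) ⟩
  ℚᵘ.mkℚᵘ (ℤ.+ m) 0
    ≈⟨ toℚᵘ-fromℕ m ⟨
  toℚᵘ (fromℕ m) ∎)
  where
  open ℚᵘ.≃-Reasoning
  cross-multiplied : ∀ x y → (x ℤ.* y) ℤ.* ℤ.1ℤ ≡ x ℤ.* (y ℤ.* ℤ.1ℤ)
  cross-multiplied = solve-∀

p*q≡0∧p≢0⇒q≡0 : ∀ p q → p * q ≡ 0ℚ → p ≢ 0ℚ → q ≡ 0ℚ
p*q≡0∧p≢0⇒q≡0 p q pq≡0 p≢0 with q ≟ 0ℚ
... | yes q≡0 = q≡0
... | no  q≢0 = contradiction pq≡0 (x#0y#0→xy#0 p≢0 q≢0)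

p≢q⇒p-q≢0 : ∀ {p q} → p ≢ q → p - q ≢ 0ℚ
p≢q⇒p-q≢0 {p} {q} p≢q = p≢q ∘ x∙y⁻¹≈ε⇒x≈y p q

Δ : (ℚ → ℚ) → ℚ → ℚ
Δ f x = f (x + 1ℚ) - f x

-- The finite-difference notion of degree: Δᵈ f is 1-periodic.  Polynomials of
-- degree ≤ d satisfy it, and it is all that extrapolation of zeros needs.
Degree≤ : ℕ → (ℚ → ℚ) → Set
Degree≤ zero    f = ∀ x → f (x + 1ℚ) ≡ f x
Degree≤ (suc d) f = Degree≤ d (Δ f)

Degree≤-cong : ∀ d {f g : ℚ → ℚ} → f ≗ g → Degree≤ d f → Degree≤ d g
Degree≤-cong zero    f≗g deg x = trans (sym (f≗g (x + 1ℚ))) (trans (deg x) (f≗g x))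
Degree≤-cong (suc d) f≗g deg = Degree≤-cong d (λ x → cong₂ _-_ (f≗g (x + 1ℚ)) (f≗g x)) deg

Degree≤0⇒Δ≡0 : ∀ f → Degree≤ 0 f → ∀ x → Δ f x ≡ 0ℚ
Degree≤0⇒Δ≡0 f deg x = trans (cong (_- f x) (deg x)) (+-inverseʳ (f x))

Degree≤-suc : ∀ d f → Degree≤ d f → Degree≤ (suc d) f
Degree≤-suc zero    f deg x = trans (Degree≤0⇒Δ≡0 f deg (x + 1ℚ)) (sym (Degree≤0⇒Δ≡0 f deg x))
Degree≤-suc (suc d) f deg = Degree≤-suc d (Δ f) deg

Degree≤-shift : ∀ d f → Degree≤ d f → Degree≤ d (λ x → f (x + 1ℚ))
Degree≤-shift zero    f deg x = deg (x + 1ℚ)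
Degree≤-shift (suc d) f deg = Degree≤-shift d (Δ f) deg

Degree≤-+ : ∀ d f g → Degree≤ d f → Degree≤ d g → Degree≤ d (λ x → f x + g x)
Degree≤-+ zero    f g degf degg x = cong₂ _+_ (degf x) (degg x)
Degree≤-+ (suc d) f g degf degg = Degree≤-cong d
  (λ x → solve 4 (λ a₁ a₀ b₁ b₀ → (a₁ :- a₀) :+ (b₁ :- b₀) := (a₁ :+ b₁) :- (a₀ :+ b₀))
                 refl (f (x + 1ℚ)) (f x) (g (x + 1ℚ)) (g x))
  (Degree≤-+ d (Δ f) (Δ g) degf degg)

Degree≤-scale : ∀ d c f → Degree≤ d f → Degree≤ d (λ x → c * f x)
Degree≤-scale zero    c f deg x = cong (c *_) (deg x)
Degree≤-scale (suc d) c f deg = Degree≤-cong d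
  (λ x → solve 3 (λ c a₁ a₀ → c :* (a₁ :- a₀) := c :* a₁ :- c :* a₀) refl c (f (x + 1ℚ)) (f x))
  (Degree≤-scale d c (Δ f) deg)

-- Δ((a + x) f) = (a + x) Δf + f(x + 1).
Degree≤-linear* : ∀ d a f → Degree≤ d f → Degree≤ (suc d) (λ x → (a + x) * f x)
Degree≤-linear* d a f deg = Degree≤-cong d
  (λ x → solve 4 (λ a x f₁ f₀ → (a :+ x) :* (f₁ :- f₀) :+ f₁
                                  := (a :+ (x :+ con 1ℚ)) :* f₁ :- (a :+ x) :* f₀)
                 refl a x (f (x + 1ℚ)) (f x))
  (discrete-leibniz d deg)
  where
  discrete-leibniz : ∀ d → Degree≤ d f → Degree≤ d (λ x → (a + x) * Δ f x + f (x + 1ℚ))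
  discrete-leibniz zero    deg = Degree≤-cong zero
    (λ x → sym (trans (cong (λ z → (a + x) * z + f (x + 1ℚ)) (Degree≤0⇒Δ≡0 f deg x))
                      (trans (cong (_+ f (x + 1ℚ)) (*-zeroʳ (a + x))) (+-identityˡ _))))
    (Degree≤-shift zero f deg)
  discrete-leibniz (suc d) deg = Degree≤-+ (suc d) (λ x → (a + x) * Δ f x) (λ x → f (x + 1ℚ))
    (Degree≤-linear* d a (Δ f) deg) (Degree≤-shift (suc d) f deg)

Δ-zeros : ∀ d f x₀ → (∀ k → k ≤ suc d → f (x₀ + fromℕ k) ≡ 0ℚ) →
          ∀ k → k ≤ d → Δ f (x₀ + fromℕ k) ≡ 0ℚ
Δ-zeros d f x₀ zeros k k≤d = cong₂ _-_
  (trans (cong f (solve 2 (λ x y → (x :+ y) :+ con 1ℚ := x :+ (con 1ℚ :+ y)) refl x₀ (fromℕ k)))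
         (zeros (suc k) (s≤s k≤d)))
  (zeros k (ℕ.m≤n⇒m≤1+n k≤d))

zeros-downward : ∀ f x₀ → f (x₀ - fromℕ 0) ≡ 0ℚ →
                 (∀ m → Δ f (x₀ - fromℕ (suc m)) ≡ 0ℚ) → ∀ m → f (x₀ - fromℕ m) ≡ 0ℚ
zeros-downward f x₀ f[x₀]≡0 Δf≡0 zero    = f[x₀]≡0
zeros-downward f x₀ f[x₀]≡0 Δf≡0 (suc m) = begin
  f (x₀ - fromℕ (suc m))         ≡⟨ x∙y⁻¹≈ε⇒x≈y _ _ (Δf≡0 m) ⟨
  f (x₀ - fromℕ (suc m) + 1ℚ)    ≡⟨ cong f (solve 2 (λ x y → (x :- (con 1ℚ :+ y)) :+ con 1ℚ := x :- y)
                                                    refl x₀ (fromℕ m)) ⟩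
  f (x₀ - fromℕ m)               ≡⟨ zeros-downward f x₀ f[x₀]≡0 Δf≡0 m ⟩
  0ℚ                             ∎
  where open ≡-Reasoning

-- By induction on d, Δf vanishes at every x₀ − m, so the zero of f at x₀ propagates
-- downwards.  (x₀ + fromℕ 0 and x₀ - fromℕ 0 agree definitionally, as - 0ℚ computes to 0ℚ.)
Degree≤-zeros-extend : ∀ d f x₀ → Degree≤ d f → (∀ k → k ≤ d → f (x₀ + fromℕ k) ≡ 0ℚ) →
                       ∀ m → f (x₀ - fromℕ m) ≡ 0ℚ
Degree≤-zeros-extend zero    f x₀ deg zeros =
  zeros-downward f x₀ (zeros 0 z≤n) (λ m → Degree≤0⇒Δ≡0 f deg _)
Degree≤-zeros-extend (suc d) f x₀ deg zeros =
  zeros-downward f x₀ (zeros 0 z≤n)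
    (Degree≤-zeros-extend d (Δ f) x₀ deg (Δ-zeros d f x₀ zeros) ∘ suc)

-- Σᵢ cᵢ / (pᵢ + x) = numerator n c p x / denominator n p x, kept free of division.
denominator : ∀ n → (Fin n → ℚ) → ℚ → ℚ
denominator zero    p x = 1ℚ
denominator (suc n) p x = (p zero + x) * denominator n (p ∘ suc) x

numerator : ∀ n → (Fin n → ℚ) → (Fin n → ℚ) → ℚ → ℚ
numerator zero    c p x = 0ℚ
numerator (suc n) c p x =
  (p zero + x) * numerator n (c ∘ suc) (p ∘ suc) x + c zero * denominator n (p ∘ suc) x

Degree≤-denominator : ∀ n p → Degree≤ n (denominator n p)
Degree≤-denominator zero    p x = refl
Degree≤-denominator (suc n) p =
  Degree≤-linear* n (p zero) (denominator n (p ∘ suc)) (Degree≤-denominator n (p ∘ suc))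

Degree≤-numerator : ∀ n c p → Degree≤ n (numerator n c p)
Degree≤-numerator zero    c p x = refl
Degree≤-numerator (suc n) c p = Degree≤-+ (suc n)
  (λ x → (p zero + x) * numerator n (c ∘ suc) (p ∘ suc) x)
  (λ x → c zero * denominator n (p ∘ suc) x)
  (Degree≤-linear* n (p zero) _ (Degree≤-numerator n (c ∘ suc) (p ∘ suc)))
  (Degree≤-scale (suc n) (c zero) _ (Degree≤-suc n _ (Degree≤-denominator n (p ∘ suc))))

sumℚ-suc : ∀ n (f : Fin (suc n) → ℚ) → sumℚ (suc n) f ≡ f zero + sumℚ n (f ∘ suc)
sumℚ-suc n f = cong (foldr _+_ 0ℚ) (map-allFin-suc n f)

sum*denominator≡numerator : ∀ n c p x w (r : Fin n → ℚ) → (∀ i → r i * (p i + x) ≡ w) →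
  sumℚ n (λ i → c i * r i) * denominator n p x ≡ w * numerator n c p x
sum*denominator≡numerator zero    c p x w r r-spec = sym (*-zeroʳ w)
sum*denominator≡numerator (suc n) c p x w r r-spec = begin
  sumℚ (suc n) (λ i → c i * r i) * ((p zero + x) * D)
    ≡⟨ cong (_* ((p zero + x) * D)) (sumℚ-suc n (λ i → c i * r i)) ⟩
  (c zero * r zero + S) * ((p zero + x) * D)
    ≡⟨ solve 6 (λ c r S a x D → (c :* r :+ S) :* ((a :+ x) :* D)
                               := c :* (r :* (a :+ x)) :* D :+ (a :+ x) :* (S :* D))
               refl (c zero) (r zero) S (p zero) x D ⟩
  c zero * (r zero * (p zero + x)) * D + (p zero + x) * (S * D)
    ≡⟨ cong₂ (λ u v → c zero * u * D + (p zero + x) * v) (r-spec zero)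
             (sum*denominator≡numerator n (c ∘ suc) (p ∘ suc) x w (r ∘ suc) (r-spec ∘ suc)) ⟩
  c zero * w * D + (p zero + x) * (w * N)
    ≡⟨ solve 6 (λ c w D a x N → c :* w :* D :+ (a :+ x) :* (w :* N)
                               := w :* ((a :+ x) :* N :+ c :* D))
               refl (c zero) w D (p zero) x N ⟩
  w * numerator (suc n) c p x ∎
  where
  open ≡-Reasoning
  S = sumℚ n (λ i → c (suc i) * r (suc i))
  D = denominator n (p ∘ suc) x
  N = numerator n (c ∘ suc) (p ∘ suc) x

denominator-≢0 : ∀ n p x → (∀ i → p i + x ≢ 0ℚ) → denominator n p x ≢ 0ℚ
denominator-≢0 zero    p x p+x≢0 = 1≢0
denominator-≢0 (suc n) p x p+x≢0 =
  x#0y#0→xy#0 (p+x≢0 zero) (denominator-≢0 n (p ∘ suc) x (p+x≢0 ∘ suc))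

-- At x = -pₖ every term of the numerator but the k-th vanishes.
numerator-roots⇒coefficients≡0 : ∀ n c p → Injective _≡_ _≡_ p →
  (∀ k → numerator n c p (- p k) ≡ 0ℚ) → ∀ i → c i ≡ 0ℚ
numerator-roots⇒coefficients≡0 zero    c p p-inj roots ()
numerator-roots⇒coefficients≡0 (suc n) c p p-inj roots = λ where
    zero    → c₀≡0
    (suc i) → numerator-roots⇒coefficients≡0 n (c ∘ suc) (p ∘ suc)
                (suc-injective ∘ p-inj) roots′ i
  where
  N D : ℚ → ℚ
  N = numerator n (c ∘ suc) (p ∘ suc)
  D = denominator n (p ∘ suc)

  p₀≢p[1+_] : ∀ k → p zero ≢ p (suc k)
  p₀≢p[1+_] k eq with () ← p-inj eq

  at-first-root : numerator (suc n) c p (- p zero) ≡ c zero * D (- p zero)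
  at-first-root = begin
    (p zero - p zero) * N (- p zero) + c zero * D (- p zero)
      ≡⟨ cong (λ z → z * N (- p zero) + c zero * D (- p zero)) (+-inverseʳ (p zero)) ⟩
    0ℚ * N (- p zero) + c zero * D (- p zero)
      ≡⟨ cong (_+ c zero * D (- p zero)) (*-zeroˡ (N (- p zero))) ⟩
    0ℚ + c zero * D (- p zero)
      ≡⟨ +-identityˡ (c zero * D (- p zero)) ⟩
    c zero * D (- p zero) ∎
    where open ≡-Reasoning

  c₀≡0 : c zero ≡ 0ℚ
  c₀≡0 = p*q≡0∧p≢0⇒q≡0 (D (- p zero)) (c zero)
    (trans (*-comm (D (- p zero)) (c zero)) (trans (sym at-first-root) (roots zero)))
    (denominator-≢0 n (p ∘ suc) (- p zero) (λ k → p≢q⇒p-q≢0 (p₀≢p[1+ k ] ∘ sym)))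

  roots′ : ∀ k → N (- p (suc k)) ≡ 0ℚ
  roots′ k = p*q≡0∧p≢0⇒q≡0 (p zero - p (suc k)) (N x) (begin
    (p zero - p (suc k)) * N x              ≡⟨ +-identityʳ _ ⟨
    (p zero - p (suc k)) * N x + 0ℚ         ≡⟨ cong ((p zero - p (suc k)) * N x +_) c₀D≡0 ⟨
    numerator (suc n) c p x                 ≡⟨ roots (suc k) ⟩
    0ℚ                                      ∎)
    (p≢q⇒p-q≢0 (p₀≢p[1+ k ]))
    where
    open ≡-Reasoning
    x = - p (suc k)
    c₀D≡0 : c zero * D x ≡ 0ℚ
    c₀D≡0 = trans (cong (_* D x) c₀≡0) (*-zeroˡ (D x))

-- r k i is the Cauchy matrix entry w / (aᵢ + k), given without division.
cauchy-rows-independent : ∀ n (a : Fin n → ℕ) → Injective _≡_ _≡_ a →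
  ∀ w → w ≢ 0ℚ → (r : ℕ → Fin n → ℚ) → (∀ k i → r k i * fromℕ (a i ℕ.+ k) ≡ w) →
  (c : Fin n → ℚ) → (∀ k → sumℚ n (λ i → c i * r k i) ≡ 0ℚ) → ∀ i → c i ≡ 0ℚ
cauchy-rows-independent n a a-inj w w≢0 r r-spec c sums≡0 =
  numerator-roots⇒coefficients≡0 n c p (a-inj ∘ fromℕ-injective) roots
  where
  p : Fin n → ℚ
  p = fromℕ ∘ a

  N : ℚ → ℚ
  N = numerator n c p

  zeros : ∀ k → N (fromℕ k) ≡ 0ℚ
  zeros k = p*q≡0∧p≢0⇒q≡0 w (N (fromℕ k)) (begin
    w * N (fromℕ k)
      ≡⟨ sum*denominator≡numerator n c p (fromℕ k) w (r k)
           (λ i → trans (cong (r k i *_) (sym (fromℕ-+ (a i) k))) (r-spec k i)) ⟨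
    sumℚ n (λ i → c i * r k i) * denominator n p (fromℕ k)
      ≡⟨ cong (_* denominator n p (fromℕ k)) (sums≡0 k) ⟩
    0ℚ * denominator n p (fromℕ k)
      ≡⟨ *-zeroˡ (denominator n p (fromℕ k)) ⟩
    0ℚ ∎) w≢0
    where open ≡-Reasoning

  roots : ∀ j → N (- p j) ≡ 0ℚ
  roots j = trans (cong N (sym (+-identityˡ (- p j))))
    (Degree≤-zeros-extend n N 0ℚ (Degree≤-numerator n c p)
      (λ k _ → trans (cong N (+-identityˡ (fromℕ k))) (zeros k)) (a j))

mainTheorem17 : InfiniteRank
mainTheorem17 n = rows , λ c vanishing →
  cauchy-rows-independent n node node-injective (fromℕ 2) (λ ()) entry entry-spec
    c (λ k → vanishing (K₂ ⊔ edgeless k))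
  where
  rows : Fin n → Graph
  rows = edgeless ∘ toℕ

  node : Fin n → ℕ
  node i = suc (toℕ i) ℕ.+ 3

  node-injective : Injective _≡_ _≡_ node
  node-injective = toℕ-injective ∘ ℕ.suc-injective ∘ ℕ.+-cancelʳ-≡ 3 _ _

  entry : ℕ → Fin n → ℚ
  entry k i = M (rows i) (K₂ ⊔ edgeless k)

  entry-spec : ∀ k i → entry k i * fromℕ (node i ℕ.+ k) ≡ fromℕ 2
  entry-spec k i = trans
    (cong₂ _*_ (M-edgeless-K₂⊔edgeless (toℕ i) k) (cong fromℕ (ℕ.+-assoc (suc (toℕ i)) 3 k)))
    (/-*-fromℕ 2 (toℕ i ℕ.+ (3 ℕ.+ k)))
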